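{- Let ${\bf x}=\sum_J a_J{\bf x}_J\in\mathcal A$. If there exist constants $a,b$ such that every symbol $[ij]$ (with $i<j$) occurring in a word ${\bf x}_J$ with $a_J\ne0$ satisfies $a<j$ and $i<b$, then ${\bf x}\in\mathcal E$, i.e. ${\bf x}$ gives a well-defined Bruhat action on $\mathbb A$.
   Context: Fix $n\ge2$. $\widetilde S_n$ is the affine symmetric group (bijections $w$ of $\mathbb Z$ with $w(i+n)=w(i)+n$, $\sum_{i=1}^n w(i)=\sum_{i=1}^n i$), with length $\ell$; for $i<j$, $i\not\equiv j\pmod n$, $t_{ij}$ swaps $i+rn$ and $j+rn$ for all $r$. $\mathbb A$ is the affine nilCoxeter algebra with basis $A_w$. $\mathcal S$ is the set of symbols $[ij]$, $i<j$ integers, $i\not\equiv j\pmod n$; $\mathcal A$ is the completion of the free algebra on $\mathcal S$ (formal possibly infinite integer combinations $\sum_J a_J{\bf x}_J$ of finite words ${\bf x}_J$), completed along the filtration by subalgebras generated by $[ij]$ with $|i|,|j|\ge N$. Bruhat action: $A_w\cdot[ij]=A_{wt_{ij}}$ if $\ell(wt_{ij})=\ell(w)-1$ and $0$ otherwise, extended multiplicatively and linearly. $\mathcal E\subset\mathcal A$ is the subalgebra of elements such that for every $w$ only finitely many terms act nonzero on $A_w$. -}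

module Defs where

open import Data.Nat as ℕ using (ℕ; NonZero)
open import Data.Integer as ℤ using (ℤ; +_; _+_; _-_; 0ℤ; _<_; _≤_; ∣_∣; _%ℕ_)
open import Data.List using (List; []; _∷_; map; foldr; upTo; length; all)
open import Data.List.Membership.Propositional using (_∈_)
open import Data.List.Relation.Unary.Unique.Propositional using (Unique)
open import Data.Product using (Σ; ∃; _×_; _,_)
open import Data.Sum using (_⊎_)
open import Data.Unit using (⊤)
open import Relation.Binary.PropositionalEquality using (_≡_; _≢_)
open import Relation.Nullary using (¬_; yes; no)
open import Function.Definitions using (Bijective)
open import Function.Bundles using (_⇔_)

sumℤ : List ℤ → ℤ
sumℤ = foldr _+_ 0ℤ

-- A "word" in the free algebra on 𝒮: a finite list of pairs (i , j) standing for
-- the symbols [ij].  Which pairs are legal symbols is recorded by IsSymbol.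
Word : Set
Word = List (ℤ × ℤ)

module _ (n : ℕ) .{{_ : NonZero n}} where

  CongMod : ℤ → ℤ → Set
  CongMod a b = (a - b) %ℕ n ≡ 0

  IsSymbol : ℤ × ℤ → Set
  IsSymbol (i , j) = (i < j) × ¬ CongMod i j

  record AffPerm : Set where
    field
      fun       : ℤ → ℤ
      bijective : Bijective _≡_ _≡_ fun
      periodic  : ∀ i → fun (i + + n) ≡ fun i + + n
      windowSum : sumℤ (map (λ k → fun (+ ℕ.suc k)) (upTo n))
                  ≡ sumℤ (map (λ k → + ℕ.suc k) (upTo n))
  open AffPerm public

  refl-t : ℤ → ℤ → ℤ → ℤ
  refl-t i j m with (m - i) %ℕ n ℕ.≟ 0
  ... | yes _ = m + (j - i)
  ... | no _ with (m - j) %ℕ n ℕ.≟ 0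
  ...   | yes _ = m - (j - i)
  ...   | no _  = m

  Inversion : (ℤ → ℤ) → ℤ × ℤ → Set
  Inversion f (p , q) = (+ 1 ≤ p) × (p ≤ + n) × (p < q) × (f q < f p)

  HasLength : (ℤ → ℤ) → ℕ → Set
  HasLength f k = Σ (List (ℤ × ℤ)) λ L →
    Unique L × length L ≡ k × (∀ pq → pq ∈ L ⇔ Inversion f pq)

  -- A_w · [ij] ≠ 0, i.e. ℓ(w t_ij) = ℓ(w) - 1
  BruhatStep : (ℤ → ℤ) → ℤ × ℤ → Set
  BruhatStep f (i , j) = ∃ λ k → HasLength f (ℕ.suc k) × HasLength (λ m → f (refl-t i j m)) k

  -- A_w · x_J ≠ 0 (right action, letters applied left to right)
  ActsNonzero : (ℤ → ℤ) → Word → Set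
  ActsNonzero f [] = ⊤
  ActsNonzero f ((i , j) ∷ J) = BruhatStep f (i , j) × ActsNonzero (λ m → f (refl-t i j m)) J

  AllLarge : ℕ → Word → Set
  AllLarge N [] = ⊤
  AllLarge N ((i , j) ∷ J) = (N ℕ.≤ ∣ i ∣) × (N ℕ.≤ ∣ j ∣) × AllLarge N J

  AllSymbols : Word → Set
  AllSymbols [] = ⊤
  AllSymbols (s ∷ J) = IsSymbol s × AllSymbols J

  -- x = Σ_J x(J) x_J ∈ 𝒜 : supported on words in 𝒮, and for every N all but
  -- finitely many terms lie in the subalgebra generated by [ij] with |i|,|j| ≥ N
  InA : (Word → ℤ) → Set
  InA x = (∀ J → x J ≢ 0ℤ → AllSymbols J)
        × (∀ N → Σ (List Word) λ L → ∀ J → x J ≢ 0ℤ → ¬ AllLarge N J → J ∈ L)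

  InE : (Word → ℤ) → Set
  InE x = InA x
        × (∀ (w : AffPerm) → Σ (List Word) λ L → ∀ J → x J ≢ 0ℤ → ActsNonzero (fun w) J → J ∈ L)

-- Fix w.  Every affine permutation moves points by a bounded amount
-- C = max_{0 ≤ r < n} |w(r) - r| (the displacement is n-periodic), hence all
-- inversions of w lie in a finite box and ℓ(w) ≤ B for an explicit B.  If
-- j - i is larger than B·n + 2C, the permutation w t_ij has at least B
-- inversions (p , p + (j - i) - x·n) for x = 1 … B, where p ∈ [1, n] is the
-- representative of the class of i; so ℓ(w t_ij) ≠ ℓ(w) - 1 and the letter
-- [ij] kills A_w.  In a word with x_J ≠ 0 whose first letter [ij] has
-- |i|, |j| ≥ N the hypotheses force i ≤ -N and j ≥ N, so for N large the
-- word acts by zero; every other word lies in the finite list given by the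
-- definition of 𝒜 for this N.
module Submission where

open import Defs
open import Data.Nat as ℕ using (ℕ; NonZero; zero; suc; z≤n; s≤s)
import Data.Nat.Properties as ℕP
open import Data.Nat.Divisibility using (n∣m⇒m%n≡0)
open import Data.Integer as ℤ
  using (ℤ; 0ℤ; +_; -[1+_]; ∣_∣; _%ℕ_; _/ℕ_; _+_; _-_; _*_; -_; _<_; _≤_; +≤+; +<+; -≤+; -<-)
import Data.Integer.Properties as ℤP
open import Data.Integer.DivMod using (a≡a%ℕn+[a/ℕn]*n; n%ℕd<d)
open import Data.Integer.Divisibility.Signed
  using (_∣_; divides; ∣⇒∣ᵤ; ∣-refl; ∣m⇒∣-m; ∣m∣n⇒∣m-n; ∣n⇒∣m*n)
open import Data.Integer.Tactic.RingSolver using (solve-∀)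
open import Data.List using (List; []; _∷_; map; length; upTo; cartesianProduct)
open import Data.List.Properties using (length-removeAt′; length-map; length-upTo)
open import Data.List.Membership.Propositional using (_∈_)
open import Data.List.Membership.Propositional.Properties
  using (∈-map⁺; ∈-map⁻; ∈-upTo⁺; ∈-upTo⁻; ∈-cartesianProduct⁺)
open import Data.List.Relation.Binary.Subset.Propositional using (_⊆_)
open import Data.List.Relation.Unary.Any using (here; there; _─_)
import Data.List.Relation.Unary.All as All
open import Data.List.Relation.Unary.AllPairs using (_∷_)
open import Data.List.Relation.Unary.Unique.Propositional using (Unique)
open import Data.List.Relation.Unary.Unique.Propositional.Properties as Unique using ()
open import Data.List.Extrema.Nat using (max; xs≤max)
open import Data.Product using (Σ; _×_; _,_; proj₁; proj₂; uncurry)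
open import Data.Empty using (⊥-elim)
open import Function using (_∘_)
open import Function.Bundles using (Equivalence)
open import Relation.Nullary using (¬_; yes; no)
open import Relation.Binary.PropositionalEquality
  using (_≡_; _≢_; refl; sym; trans; cong; subst; module ≡-Reasoning)

module _ {A : Set} where

  ∈-─ : ∀ {x y : A} {ys} (x∈ys : x ∈ ys) → y ∈ ys → y ≢ x → y ∈ (ys ─ x∈ys)
  ∈-─ (here refl) (here refl) y≢x = ⊥-elim (y≢x refl)
  ∈-─ (here refl) (there y∈ys) _  = y∈ys
  ∈-─ (there _)   (here refl) _   = here refl
  ∈-─ (there x∈ys) (there y∈ys) y≢x = there (∈-─ x∈ys y∈ys y≢x)

  unique-⊆-length : ∀ {xs ys : List A} → Unique xs → xs ⊆ ys → length xs ℕ.≤ length ys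
  unique-⊆-length {[]}     _             _  = z≤n
  unique-⊆-length {x ∷ xs} {ys} (x∉xs ∷ u) xs⊆ys =
    subst (suc (length xs) ℕ.≤_) (sym (length-removeAt′ ys _))
      (s≤s (unique-⊆-length u λ z∈xs →
        ∈-─ x∈ys (xs⊆ys (there z∈xs)) (λ z≡x → All.lookup x∉xs z∈xs (sym z≡x))))
    where x∈ys : x ∈ ys
          x∈ys = xs⊆ys (here refl)

module _ {A : Set} (h : ℤ → A) (N : ℤ) (inv : ∀ m → h (m + N) ≡ h m) where

  shift-invariant-ℕ : ∀ m (k : ℕ) → h (m + + k * N) ≡ h m
  shift-invariant-ℕ m zero    = cong h (ring m N)
    where ring : ∀ m N → m + + 0 * N ≡ m
          ring = solve-∀
  shift-invariant-ℕ m (suc k) =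
    trans (cong h (ring m (+ k) N)) (trans (inv _) (shift-invariant-ℕ m k))
    where ring : ∀ m k N → m + (+ 1 + k) * N ≡ m + k * N + N
          ring = solve-∀

  shift-invariant : ∀ m k → h (m + k * N) ≡ h m
  shift-invariant m (+ k)    = shift-invariant-ℕ m k
  shift-invariant m -[1+ k ] =
    sym (trans (cong h (ring m (+ suc k) N)) (shift-invariant-ℕ _ (suc k)))
    where ring : ∀ m x N → m ≡ m + (- x) * N + x * N
          ring = solve-∀

∣∣≤⇒bounds : ∀ z c → ∣ z ∣ ℕ.≤ c → (- + c ≤ z) × (z ≤ + c)
∣∣≤⇒bounds (+ k)    c k≤c = ℤP.≤-trans (ℤP.neg-mono-≤ (+≤+ z≤n)) (+≤+ z≤n) , +≤+ k≤c
∣∣≤⇒bounds -[1+ k ] c k<c = ℤP.neg-mono-≤ (+≤+ k<c) , -≤+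

above-large : ∀ N c j → ∣ c ∣ ℕ.< N → N ℕ.≤ ∣ j ∣ → c < j → + N ≤ j
above-large N c        (+ k)    _   N≤k _ = +≤+ N≤k
above-large N -[1+ m ] -[1+ k ] c<N N≤j (-<- k<m) =
  ⊥-elim (ℕP.<-irrefl refl (ℕP.<-trans (s≤s k<m) (ℕP.<-≤-trans c<N N≤j)))

below-large : ∀ N c i → ∣ c ∣ ℕ.< N → N ℕ.≤ ∣ i ∣ → i < c → + N ≤ - i
below-large N (+ m)    (+ k)    c<N N≤i (+<+ k<m) =
  ⊥-elim (ℕP.<-irrefl refl (ℕP.<-trans k<m (ℕP.<-≤-trans c<N N≤i)))
below-large N -[1+ m ] (+ k)    _   _   ()
below-large N c        -[1+ k ] _   N≤i _ = +≤+ N≤i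

endpoints-far-apart : ∀ N {a b i j} → ∣ a ∣ ℕ.< N → ∣ b ∣ ℕ.< N → N ℕ.≤ ∣ i ∣ → N ℕ.≤ ∣ j ∣
                    → a < j → i < b → + N ≤ j - i
endpoints-far-apart N {a} {b} {i} {j} a<N b<N N≤i N≤j a<j i<b =
  ℤP.≤-trans (ℤP.i≤i+j (+ N) (+ N))
    (ℤP.+-mono-≤ (above-large N a j a<N N≤j a<j) (below-large N b i b<N N≤i i<b))

module _ (n : ℕ) .{{_ : NonZero n}} where

  %ℕ≡0⇒∣ : ∀ a → a %ℕ n ≡ 0 → + n ∣ a
  %ℕ≡0⇒∣ a r≡0 = divides (a /ℕ n)
    (trans (a≡a%ℕn+[a/ℕn]*n a n) (trans (cong (λ r → + r + (a /ℕ n) * + n) r≡0) (ℤP.+-identityˡ _)))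

  ∣⇒%ℕ≡0 : ∀ a → + n ∣ a → a %ℕ n ≡ 0
  ∣⇒%ℕ≡0 (+ m) n∣a = n∣m⇒m%n≡0 m n (∣⇒∣ᵤ n∣a)
  ∣⇒%ℕ≡0 -[1+ m ] n∣a with suc m ℕ.% n | n∣m⇒m%n≡0 (suc m) n (∣⇒∣ᵤ n∣a)
  ... | zero  | _  = refl
  ... | suc _ | ()

  t-on-class-of-i : ∀ i j m → + n ∣ (m - i) → refl-t n i j m ≡ m + (j - i)
  t-on-class-of-i i j m n∣m-i with (m - i) %ℕ n ℕ.≟ 0
  ... | yes _   = refl
  ... | no r≢0  = ⊥-elim (r≢0 (∣⇒%ℕ≡0 _ n∣m-i))

  t-on-class-of-j : ∀ i j m → ¬ (+ n ∣ (m - i)) → + n ∣ (m - j) → refl-t n i j m ≡ m - (j - i)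
  t-on-class-of-j i j m n∤m-i n∣m-j with (m - i) %ℕ n ℕ.≟ 0
  ... | yes r≡0 = ⊥-elim (n∤m-i (%ℕ≡0⇒∣ _ r≡0))
  ... | no _ with (m - j) %ℕ n ℕ.≟ 0
  ...   | yes _  = refl
  ...   | no r≢0 = ⊥-elim (r≢0 (∣⇒%ℕ≡0 _ n∣m-j))

  Periodic : (ℤ → ℤ) → Set
  Periodic f = ∀ m → f (m + + n) ≡ f m + + n

  module _ (f : ℤ → ℤ) (per : Periodic f) where

    displacement : ℤ → ℤ
    displacement m = f m - m

    -- The displacement is n-periodic, so it is bounded by its maximum on [0, n).
    displacement-periodic : ∀ m k → displacement (m + k * + n) ≡ displacement m
    displacement-periodic = shift-invariant displacement (+ n) λ m → begin
      f (m + + n) - (m + + n) ≡⟨ cong (_- (m + + n)) (per m) ⟩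
      f m + + n - (m + + n)   ≡⟨ ring (f m) m (+ n) ⟩
      f m - m                 ∎
      where open ≡-Reasoning
            ring : ∀ a m n → a + n - (m + n) ≡ a - m
            ring = solve-∀

    C : ℕ
    C = max 0 (map (λ r → ∣ displacement (+ r) ∣) (upTo n))

    displacement-bound : ∀ m → ∣ displacement m ∣ ℕ.≤ C
    displacement-bound m = subst (λ d → ∣ d ∣ ℕ.≤ C) d[r]≡d[m]
      (All.lookup (xs≤max 0 _) (∈-map⁺ (λ r → ∣ displacement (+ r) ∣) (∈-upTo⁺ (n%ℕd<d m n))))
      where
      d[r]≡d[m] : displacement (+ (m %ℕ n)) ≡ displacement m
      d[r]≡d[m] = trans (sym (displacement-periodic _ (m /ℕ n)))
                        (cong displacement (sym (a≡a%ℕn+[a/ℕn]*n m n)))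

    f-upper : ∀ m → f m ≤ m + + C
    f-upper m = subst (_≤ m + + C) (ring (f m) m)
      (ℤP.+-monoʳ-≤ m (proj₂ (∣∣≤⇒bounds _ C (displacement-bound m))))
      where ring : ∀ a m → m + (a - m) ≡ a
            ring = solve-∀

    f-lower : ∀ m → m - + C ≤ f m
    f-lower m = subst (m - + C ≤_) (ring (f m) m)
      (ℤP.+-monoʳ-≤ m (proj₁ (∣∣≤⇒bounds _ C (displacement-bound m))))
      where ring : ∀ a m → m + (a - m) ≡ a
            ring = solve-∀

    -- Every inversion (p , q) has 0 ≤ p < q < n + 2C, so it lies in a finite box.
    window : List ℤ
    window = map +_ (upTo (n ℕ.+ C ℕ.+ C))

    box : List (ℤ × ℤ)
    box = cartesianProduct window window

    B : ℕ
    B = length box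

    ∈-window : ∀ {p} → + 0 ≤ p → p < + (n ℕ.+ C ℕ.+ C) → p ∈ window
    ∈-window {+ _} _ (+<+ p<K) = ∈-map⁺ +_ (∈-upTo⁺ p<K)

    inversion∈box : ∀ {p q} → Inversion n f (p , q) → (p , q) ∈ box
    inversion∈box {p} {q} (1≤p , p≤n , p<q , fq<fp) =
      ∈-cartesianProduct⁺ (∈-window 0≤p (ℤP.<-trans p<q q<K)) (∈-window (ℤP.≤-trans 0≤p (ℤP.<⇒≤ p<q)) q<K)
      where
      open ℤP.≤-Reasoning
      0≤p : + 0 ≤ p
      0≤p = ℤP.≤-trans (+≤+ z≤n) 1≤p
      q<K : q < + (n ℕ.+ C ℕ.+ C)
      q<K = begin-strict
        q                     ≡⟨ ring q (+ C) ⟩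
        q - + C + + C         ≤⟨ ℤP.+-monoˡ-≤ (+ C) (f-lower q) ⟩
        f q + + C             <⟨ ℤP.+-monoˡ-< (+ C) fq<fp ⟩
        f p + + C             ≤⟨ ℤP.+-monoˡ-≤ (+ C) (ℤP.≤-trans (f-upper p) (ℤP.+-monoˡ-≤ (+ C) p≤n)) ⟩
        + (n ℕ.+ C ℕ.+ C)     ∎
        where ring : ∀ q c → q ≡ q - c + c
              ring = solve-∀

    length-bound : ∀ {k} → HasLength n f k → k ℕ.≤ B
    length-bound (L , unique , refl , iff) =
      unique-⊆-length unique (inversion∈box ∘ Equivalence.to (iff _))

    -- A reflection t_ij with j - i > B·n + 2C is never a Bruhat step down from f.
    reflection-bound : ℕ
    reflection-bound = B ℕ.* n ℕ.+ (C ℕ.+ C)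

    module LongReflection (i j : ℤ) (i≢j : ¬ CongMod n i j) (long : + reflection-bound < j - i) where

      D : ℤ
      D = j - i

      n∤D : ¬ (+ n ∣ D)
      n∤D n∣D = i≢j (∣⇒%ℕ≡0 _ (subst (+ n ∣_) (ring i j) (∣m⇒∣-m n∣D)))
        where ring : ∀ i j → - (j - i) ≡ i - j
              ring = solve-∀

      r : ℕ
      r = (i - + 1) %ℕ n

      p : ℤ
      p = + suc r

      n∣p-i : + n ∣ (p - i)
      n∣p-i = divides (- ((i - + 1) /ℕ n)) (begin
        + 1 + + r - i                      ≡⟨ ring₁ (+ r) i ⟩
        + r - (i - + 1)                    ≡⟨ cong (_-_ (+ r)) (a≡a%ℕn+[a/ℕn]*n (i - + 1) n) ⟩
        + r - (+ r + (i - + 1) /ℕ n * + n) ≡⟨ ring₂ (+ r) ((i - + 1) /ℕ n) (+ n) ⟩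
        - ((i - + 1) /ℕ n) * + n           ∎)
        where open ≡-Reasoning
              ring₁ : ∀ r i → + 1 + r - i ≡ r - (i - + 1)
              ring₁ = solve-∀
              ring₂ : ∀ r d n → r - (r + d * n) ≡ (- d) * n
              ring₂ = solve-∀

      -- The partner points far x ≡ j, lying x·n below p + D = t_ij(p).
      far : ℕ → ℤ
      far x = j + (p - i) - + x * + n

      n∣far-j : ∀ x → + n ∣ (far x - j)
      n∣far-j x = subst (+ n ∣_) (ring j (p - i) (+ x * + n))
                    (∣m∣n⇒∣m-n n∣p-i (∣n⇒∣m*n (+ x) ∣-refl))
        where ring : ∀ j e y → e - y ≡ j + e - y - j
              ring = solve-∀

      n∤far-i : ∀ x → ¬ (+ n ∣ (far x - i))
      n∤far-i x n∣far-i = n∤D (subst (+ n ∣_) (ring (far x) i j) (∣m∣n⇒∣m-n n∣far-i (n∣far-j x)))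
        where ring : ∀ y i j → y - i - (y - j) ≡ j - i
              ring = solve-∀

      t-p : refl-t n i j p ≡ p + D
      t-p = t-on-class-of-i i j p n∣p-i

      t-far : ∀ x → refl-t n i j (far x) ≡ p - + x * + n
      t-far x = trans (t-on-class-of-j i j (far x) (n∤far-i x) (n∣far-j x)) (ring j p i (+ x * + n))
        where ring : ∀ j p i y → j + (p - i) - y - (j - i) ≡ p - y
              ring = solve-∀

      g : ℤ → ℤ
      g m = f (refl-t n i j m)

      far-inversion : ∀ x → x ℕ.≤ B → Inversion n g (p , far x)
      far-inversion x x≤B = +≤+ (s≤s z≤n) , +≤+ (n%ℕd<d (i - + 1) n) , p<far , g-far<g-p
        where
        open ℤP.≤-Reasoning
        y : ℤ
        y = + x * + n
        0≤y : + 0 ≤ y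
        0≤y = subst (+ 0 ≤_) (ℤP.pos-* x n) (+≤+ z≤n)
        y<D : y < D
        y<D = begin-strict
          + x * + n              ≤⟨ ℤP.*-monoʳ-≤-nonNeg (+ n) (+≤+ x≤B) ⟩
          + B * + n              ≡⟨ sym (ℤP.pos-* B n) ⟩
          + (B ℕ.* n)            ≤⟨ +≤+ (ℕP.m≤m+n _ _) ⟩
          + reflection-bound     <⟨ long ⟩
          D                      ∎
        2C<D : + C + + C < D
        2C<D = ℤP.≤-<-trans (+≤+ (ℕP.m≤n+m (C ℕ.+ C) (B ℕ.* n))) long
        p<far : p < far x
        p<far = begin-strict
          p                      ≡⟨ ring₁ p y ⟩
          p + y - y              <⟨ ℤP.+-monoˡ-< (- y) (ℤP.+-monoʳ-< p y<D) ⟩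
          p + D - y              ≡⟨ ring₂ p i j y ⟩
          far x                  ∎
          where ring₁ : ∀ p y → p ≡ p + y - y
                ring₁ = solve-∀
                ring₂ : ∀ p i j y → p + (j - i) - y ≡ j + (p - i) - y
                ring₂ = solve-∀
        g-far<g-p : g (far x) < g p
        g-far<g-p = begin-strict
          f (refl-t n i j (far x)) ≡⟨ cong f (t-far x) ⟩
          f (p - y)                ≤⟨ f-upper (p - y) ⟩
          p - y + + C              ≤⟨ ℤP.+-monoˡ-≤ (+ C) (ℤP.i-j≤i p y {{ℤ.nonNegative 0≤y}}) ⟩
          p + + C                  ≡⟨ ring p (+ C) ⟩
          p + (+ C + + C) - + C    <⟨ ℤP.+-monoˡ-< (- + C) (ℤP.+-monoʳ-< p 2C<D) ⟩
          p + D - + C              ≤⟨ f-lower (p + D) ⟩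
          f (p + D)                ≡⟨ cong f (sym t-p) ⟩
          f (refl-t n i j p)       ∎
          where ring : ∀ p c → p + c ≡ p + (c + c) - c
                ring = solve-∀

      far-injective : ∀ {x x′} → far x ≡ far x′ → x ≡ x′
      far-injective {x} {x′} eq = ℤP.+-injective (ℤP.*-cancelʳ-≡ (+ x) (+ x′) (+ n) (begin
        + x * + n         ≡⟨ ring e (+ x * + n) ⟩
        e - far x         ≡⟨ cong (_-_ e) eq ⟩
        e - far x′        ≡⟨ sym (ring e (+ x′ * + n)) ⟩
        + x′ * + n        ∎))
        where open ≡-Reasoning
              e : ℤ
              e = j + (p - i)
              ring : ∀ e y → y ≡ e - (e - y)
              ring = solve-∀

      -- Hence ℓ(f ∘ t_ij) ≥ B ≥ ℓ(f), so t_ij cannot lower the length by one.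
      not-a-step : ¬ BruhatStep n f (i , j)
      not-a-step (k , ℓf≡k+1 , (L , unique , refl , iff)) =
        ℕP.<-irrefl refl (ℕP.<-≤-trans (length-bound ℓf≡k+1) B≤ℓg)
        where
        far-pairs : List (ℤ × ℤ)
        far-pairs = map (λ s → p , far (suc s)) (upTo B)
        far-pairs⊆inversions : far-pairs ⊆ L
        far-pairs⊆inversions {z} z∈ with ∈-map⁻ (λ s → p , far (suc s)) z∈
        ... | s , s∈ , refl =
          Equivalence.from (iff _) (far-inversion (suc s) (∈-upTo⁻ s∈))
        B≤ℓg : B ℕ.≤ length L
        B≤ℓg = subst (ℕ._≤ length L) (trans (length-map _ (upTo B)) (length-upTo B))
          (unique-⊆-length (Unique.map⁺ (ℕP.suc-injective ∘ far-injective ∘ cong proj₂) (Unique.upTo⁺ B))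
                           far-pairs⊆inversions)

    long-reflection-not-step : ∀ i j → ¬ CongMod n i j → + reflection-bound < j - i → ¬ BruhatStep n f (i , j)
    long-reflection-not-step i j i≢j long = LongReflection.not-a-step i j i≢j long

corollary3p3 : (n : ℕ) .{{_ : NonZero n}} → 2 ℕ.≤ n → (x : Word → ℤ) → InA n x
    → (a b : ℤ) → (∀ J → x J ≢ 0ℤ → ∀ i j → (i , j) ∈ J → (a < j) × (i < b))
    → InE n x
corollary3p3 n _ x inA a b endpoints = inA , finitely-many-act
  where
  finitely-many-act : ∀ (w : AffPerm n) → Σ (List Word) λ L → ∀ J → x J ≢ 0ℤ → ActsNonzero n (fun w) J → J ∈ L
  finitely-many-act w = [] ∷ small-words , covered
    where
    M N : ℕ
    M = reflection-bound n (fun w) (periodic w)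
    N = suc (M ℕ.+ ∣ a ∣ ℕ.+ ∣ b ∣)
    M<N : M ℕ.< N
    M<N = s≤s (ℕP.≤-trans (ℕP.m≤m+n M _) (ℕP.m≤m+n _ _))
    a<N : ∣ a ∣ ℕ.< N
    a<N = s≤s (ℕP.≤-trans (ℕP.m≤n+m _ M) (ℕP.m≤m+n _ _))
    b<N : ∣ b ∣ ℕ.< N
    b<N = s≤s (ℕP.m≤n+m _ _)
    small-words : List Word
    small-words = proj₁ (proj₂ inA N)
    large-first-letter-kills : ∀ i j J → x ((i , j) ∷ J) ≢ 0ℤ → N ℕ.≤ ∣ i ∣ → N ℕ.≤ ∣ j ∣
                             → ¬ BruhatStep n (fun w) (i , j)
    large-first-letter-kills i j J xJ≢0 N≤i N≤j =
      long-reflection-not-step n (fun w) (periodic w) i j (proj₂ (proj₁ (proj₁ inA _ xJ≢0)))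
        (ℤP.<-≤-trans (+<+ M<N)
          (uncurry (endpoints-far-apart N a<N b<N N≤i N≤j) (endpoints _ xJ≢0 i j (here refl))))
    covered : ∀ J → x J ≢ 0ℤ → ActsNonzero n (fun w) J → J ∈ [] ∷ small-words
    covered [] _ _ = here refl
    covered ((i , j) ∷ J) xJ≢0 (step , _) with N ℕ.≤? ∣ i ∣ | N ℕ.≤? ∣ j ∣
    ... | yes N≤i | yes N≤j = ⊥-elim (large-first-letter-kills i j J xJ≢0 N≤i N≤j step)
    ... | no N≰i  | _       = there (proj₂ (proj₂ inA N) _ xJ≢0 (N≰i ∘ proj₁))
    ... | yes _   | no N≰j  = there (proj₂ (proj₂ inA N) _ xJ≢0 (N≰j ∘ proj₁ ∘ proj₂))
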